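{- Let $n\ge1$ and let $\nu,\mu,\lambda$ be partitions with $\ell(\nu)\le 2n-1$, $\ell(\mu)\le n$, $\lambda$ even and $\lambda,\mu\subseteq\nu$. Let $\phi=(\phi_1,\dots,\phi_{2n})$ with $\phi_k=n+\lfloor k/2\rfloor$. Then the image of $\operatorname{LRS}(\nu/\mu,\lambda)$ under the companion map $c$ is exactly the set of $\mu$-dominant tableaux in $\mathrm{SSYT}(\lambda,\phi)$ of content $\nu-\mu$, i.e. $c(\operatorname{LRS}(\nu/\mu,\lambda))=\operatorname{LR}^{\nu}_{\mu,\lambda}\cap\mathrm{SSYT}(\lambda,\phi)$.
   Context: Partitions are identified with Young diagrams; $\ell(\nu)$ is the number of nonzero parts; $\lambda$ is even if $\lambda_{2i-1}=\lambda_{2i}$ for all $i$. The reverse row word $w(T)$ of a (possibly skew) semistandard tableau reads the positive entries of each row right to left, rows from top to bottom. The content of a word/tableau is $(\alpha_1,\alpha_2,\dots)$ with $\alpha_i$ the number of occurrences of $i$. A word is Yamanouchi if the content of each of its prefixes is a partition. $\operatorname{LR}(\nu/\mu,\lambda)$ is the set of semistandard tableaux of skew shape $\nu/\mu$ and content $\lambda$ with Yamanouchi reverse row word. $T\in\operatorname{LR}(\nu/\mu,\lambda)$ has the Sundaram property if for each $i=0,1,\dots,\ell(\lambda)/2$ every occurrence of the entry $2i+1$ lies in row $n+i$ or above; $\operatorname{LRS}(\nu/\mu,\lambda)$ is the set of such $T$. The companion tableau $c(T)$ of $T\in\operatorname{LR}(\nu/\mu,\lambda)$ is the tableau of shape $\lambda$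 whose $k$-th row lists, in weakly increasing order, the row indices of all boxes of $T$ containing $k$ (with multiplicity). With $T_\mu$ the tableau of shape $\mu$ whose $i$-th row is filled with $i$'s, a semistandard Young tableau $R$ is $\mu$-dominant if $w(T_\mu)w(R)$ is Yamanouchi; $\operatorname{LR}^{\nu}_{\mu,\lambda}$ is the set of $\mu$-dominant semistandard Young tableaux of shape $\lambda$ and content $\nu-\mu$. For a partition $\lambda$ and a weakly increasing tuple $\phi$, $\mathrm{SSYT}(\lambda,\phi)$ is the set of semistandard Young tableaux of shape $\lambda$ whose entries in row $k$ are all at most $\phi_k$, for every $k$. -}

module Defs where

open import Data.Nat using (ℕ; zero; suc; _+_; _*_; _∸_; _≤_; _<_; _/_; _≟_)
open import Relation.Nullary using (yes; no)
open import Data.List using (List; []; _∷_; length; map; concat; reverse; replicate; zipWith; upTo; take; _++_)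
open import Data.List.Membership.Propositional using (_∈_)
open import Data.Product using (_×_)
open import Relation.Binary.PropositionalEquality using (_≡_)

lookupD : {A : Set} → A → List A → ℕ → A
lookupD d []       _       = d
lookupD d (x ∷ xs) zero    = x
lookupD d (x ∷ xs) (suc i) = lookupD d xs i

-- part i (0-indexed) of a partition, 0 beyond the length
part : List ℕ → ℕ → ℕ
part = lookupD 0

row : List (List ℕ) → ℕ → List ℕ
row = lookupD []

IsPartition : List ℕ → Set
IsPartition ν = (∀ i → suc i < length ν → part ν (suc i) ≤ part ν i)
              × (∀ i → i < length ν → 1 ≤ part ν i)

IsEven : List ℕ → Set
IsEven λ′ = ∀ i → part λ′ (2 * i) ≡ part λ′ (2 * i + 1)

_⊆ᵖ_ : List ℕ → List ℕ → Set
λ′ ⊆ᵖ ν = ∀ i → part λ′ i ≤ part ν i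

-- A (skew) tableau of shape ν/μ is a list of rows; row i lists the entries
-- of the boxes in columns μ_i+1 .. ν_i (the boxes of ν/μ) from left to right.
IsSkewShape : List ℕ → List ℕ → List (List ℕ) → Set
IsSkewShape ν μ T = (length T ≡ length ν)
                  × (∀ i → length (row T i) + part μ i ≡ part ν i)

IsSkewSSYT : List ℕ → List ℕ → List (List ℕ) → Set
IsSkewSSYT ν μ T =
    IsSkewShape ν μ T
  × (∀ i x → x ∈ row T i → 1 ≤ x)
  × (∀ i j → suc j < length (row T i) → part (row T i) j ≤ part (row T i) (suc j))
  -- box (row i+1, column c = μ_{i+1} + j) has a box above it iff c ≥ μ_i
  × (∀ i j → j < length (row T (suc i)) → part μ i ≤ part μ (suc i) + j →
       part (row T i) (part μ (suc i) + j ∸ part μ i) < part (row T (suc i)) j)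

IsSSYT : List ℕ → List (List ℕ) → Set
IsSSYT λ′ R = IsSkewSSYT λ′ [] R

occ : ℕ → List ℕ → ℕ
occ k [] = 0
occ k (x ∷ w) with x ≟ k
... | yes _ = suc (occ k w)
... | no _  = occ k w

rrw : List (List ℕ) → List ℕ
rrw T = concat (map reverse T)

-- the word has content α (entries assumed positive)
HasContent : List ℕ → List ℕ → Set
HasContent w α = ∀ k → occ (suc k) w ≡ part α k

Yamanouchi : List ℕ → Set
Yamanouchi w = ∀ m k → occ (suc (suc k)) (take m w) ≤ occ (suc k) (take m w)

IsLR : List ℕ → List ℕ → List ℕ → List (List ℕ) → Set
IsLR ν μ λ′ T = IsSkewSSYT ν μ T × HasContent (rrw T) λ′ × Yamanouchi (rrw T)

-- Sundaram property: for i = 0..ℓ(λ)/2 every 2i+1 lies in row n+i or above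
-- (rows 1-indexed; here row index r is 0-indexed, so r+1 ≤ n+i)
Sundaram : ℕ → List ℕ → List (List ℕ) → Set
Sundaram n λ′ T = ∀ i r → i ≤ length λ′ / 2 → (2 * i + 1) ∈ row T r → suc r ≤ n + i

IsLRS : ℕ → List ℕ → List ℕ → List ℕ → List (List ℕ) → Set
IsLRS n ν μ λ′ T = IsLR ν μ λ′ T × Sundaram n λ′ T

-- k-th row of the companion tableau: row indices (1-indexed) of boxes containing k
companionRow : List (List ℕ) → ℕ → List ℕ
companionRow T k = concat (zipWith (λ r ρ → replicate (occ k ρ) (suc r)) (upTo (length T)) T)

companion : List ℕ → List (List ℕ) → List (List ℕ)
companion λ′ T = map (λ k → companionRow T (suc k)) (upTo (length λ′))

Tμ : List ℕ → List (List ℕ)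
Tμ μ = zipWith (λ i m → replicate m (suc i)) (upTo (length μ)) μ

MuDominant : List ℕ → List (List ℕ) → Set
MuDominant μ R = Yamanouchi (rrw (Tμ μ) ++ rrw R)

IsLRdom : List ℕ → List ℕ → List ℕ → List (List ℕ) → Set
IsLRdom ν μ λ′ R = IsSSYT λ′ R × MuDominant μ R × (∀ k → occ (suc k) (rrw R) ≡ part ν k ∸ part μ k)

φ : ℕ → ℕ → ℕ
φ n k = n + k / 2

IsSSYTφ : ℕ → List ℕ → List (List ℕ) → Set
IsSSYTφ n λ′ R = IsSSYT λ′ R × (∀ r x → suc r ≤ 2 * n → x ∈ row R r → x ≤ φ n (suc r))

-- The companion map transposes multiplicities: T has as many k's in row i as c(T) has i's in row k.
-- Reading both sides through counts, the Yamanouchi condition on w(T) becomes column strictness of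
-- c(T), and column strictness of the skew tableau T becomes μ-dominance of c(T), while content and
-- shape are exchanged. Since a sorted row is determined by its multiplicities, c is inverted by taking
-- the companion of R with ℓ(ν) rows. Finally an entry 2i+1 in row r of T is an entry r+1 in row 2i+1
-- of c(T), so the Sundaram condition and the bound φ restrict the same boxes; the even entries of T are
-- controlled because below row ℓ(μ) ≤ n every entry of T lies under a strictly smaller one.
module Submission where

open import Defs
open import Data.Nat using (ℕ; zero; suc; _+_; _*_; _∸_; _≤_; _<_; _/_; _≟_; _≤?_; _<?_; z≤n; s≤s)
open import Data.Nat.Properties
open import Data.Nat.Induction using (<-rec)
open import Data.Nat.DivMod using (m/n≡1+[m∸n]/n; /-monoˡ-≤)
open import Data.List
  using (List; []; _∷_; length; map; concat; reverse; replicate; zipWith; upTo; take; _++_; applyUpTo)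
open import Data.List.Properties using (unfold-reverse; take-all; length-map; length-applyUpTo)
open import Data.List.Membership.Propositional using (_∈_; _∉_; find; lose)
open import Data.List.Membership.Propositional.Properties using (∈-++⁻; ∈-++⁺ˡ; ∈-++⁺ʳ)
open import Data.List.Relation.Unary.Any using (Any; here; there; tail)
open import Data.List.Relation.Unary.Any.Properties using (reverse⁺)
open import Data.List.Relation.Unary.All as All using ([]; _∷_)
import Data.List.Relation.Unary.All.Properties as All
open import Data.List.Relation.Unary.AllPairs using (AllPairs; []; _∷_)
import Data.List.Relation.Unary.AllPairs.Properties as AllPairs
open import Data.Product using (Σ; ∃; _×_; _,_; proj₁; proj₂)
open import Data.Sum using (_⊎_; inj₁; inj₂)
open import Function using (_∘_)
open import Function.Bundles using (_⇔_; mk⇔)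
open import Relation.Nullary using (Dec; yes; no; contradiction)
open import Relation.Binary.PropositionalEquality

occ-++ : ∀ k u v → occ k (u ++ v) ≡ occ k u + occ k v
occ-++ k [] v = refl
occ-++ k (x ∷ u) v with x ≟ k
... | yes _ = cong suc (occ-++ k u v)
... | no _  = occ-++ k u v

occ-reverse : ∀ k u → occ k (reverse u) ≡ occ k u
occ-reverse k [] = refl
occ-reverse k (x ∷ u) = begin
  occ k (reverse (x ∷ u))            ≡⟨ cong (occ k) (unfold-reverse x u) ⟩
  occ k (reverse u ++ x ∷ [])        ≡⟨ occ-++ k (reverse u) (x ∷ []) ⟩
  occ k (reverse u) + occ k (x ∷ []) ≡⟨ cong (_+ occ k (x ∷ [])) (occ-reverse k u) ⟩
  occ k u + occ k (x ∷ [])           ≡⟨ +-comm (occ k u) _ ⟩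
  occ k (x ∷ []) + occ k u           ≡⟨ occ-++ k (x ∷ []) u ⟨
  occ k (x ∷ u)                      ∎
  where open ≡-Reasoning

occ-∷-≢ : ∀ {k z} u → z ≢ k → occ k (z ∷ u) ≡ occ k u
occ-∷-≢ {k} {z} u z≢k with z ≟ k
... | yes z≡k = contradiction z≡k z≢k
... | no _    = refl

occ≤occ-∷ : ∀ k z u → occ k u ≤ occ k (z ∷ u)
occ≤occ-∷ k z u with z ≟ k
... | yes _ = n≤1+n _
... | no _  = ≤-refl

∈⇒occ>0 : ∀ {x} u → x ∈ u → 0 < occ x u
∈⇒occ>0 {x} (y ∷ u) x∈ with y ≟ x
... | yes _   = s≤s z≤n
... | no y≢x = ∈⇒occ>0 u (tail (y≢x ∘ sym) x∈)

occ>0⇒∈ : ∀ {x} u → 0 < occ x u → x ∈ u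
occ>0⇒∈ {x} (y ∷ u) occ>0 with y ≟ x
... | yes refl = here refl
... | no _     = there (occ>0⇒∈ u occ>0)

∉⇒occ≡0 : ∀ {x} u → x ∉ u → occ x u ≡ 0
∉⇒occ≡0 [] _ = refl
∉⇒occ≡0 {x} (y ∷ u) x∉ with y ≟ x
... | yes refl = contradiction (here refl) x∉
... | no _     = ∉⇒occ≡0 u (x∉ ∘ there)

∈-replicate⇒≡ : ∀ {y x : ℕ} m → y ∈ replicate m x → y ≡ x
∈-replicate⇒≡ (suc m) (here y≡x) = y≡x
∈-replicate⇒≡ (suc m) (there y∈) = ∈-replicate⇒≡ m y∈

occ-replicate-≡ : ∀ k m → occ k (replicate m k) ≡ m
occ-replicate-≡ k zero = refl
occ-replicate-≡ k (suc m) with k ≟ k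
... | yes _   = cong suc (occ-replicate-≡ k m)
... | no k≢k = contradiction refl k≢k

occ-replicate-≢ : ∀ {k x} m → x ≢ k → occ k (replicate m x) ≡ 0
occ-replicate-≢ m x≢k = ∉⇒occ≡0 (replicate m _) (x≢k ∘ sym ∘ ∈-replicate⇒≡ m)

countAtMost : ℕ → List ℕ → ℕ
countAtMost v [] = 0
countAtMost v (x ∷ u) with x ≤? v
... | yes _ = suc (countAtMost v u)
... | no _  = countAtMost v u

countAtMost≤length : ∀ v u → countAtMost v u ≤ length u
countAtMost≤length v [] = z≤n
countAtMost≤length v (x ∷ u) with x ≤? v
... | yes _ = s≤s (countAtMost≤length v u)
... | no _  = m≤n⇒m≤1+n (countAtMost≤length v u)

countAtMost-suc : ∀ v u → countAtMost (suc v) u ≡ countAtMost v u + occ (suc v) u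
countAtMost-suc v [] = refl
countAtMost-suc v (x ∷ u) with x ≤? suc v | x ≤? v | x ≟ suc v
... | yes _     | yes x≤v | yes refl  = contradiction x≤v 1+n≰n
... | yes _     | yes _   | no _      = cong suc (countAtMost-suc v u)
... | yes _     | no _    | yes _     = trans (cong suc (countAtMost-suc v u)) (sym (+-suc _ _))
... | yes x≤1+v | no x≰v  | no x≢1+v = contradiction (≤-antisym x≤1+v (≰⇒> x≰v)) x≢1+v
... | no x≰1+v  | yes x≤v | _         = contradiction (m≤n⇒m≤1+n x≤v) x≰1+v
... | no x≰1+v  | no _    | yes refl  = contradiction ≤-refl x≰1+v
... | no _      | no _    | no _      = countAtMost-suc v u

Positive : List ℕ → Set
Positive u = ∀ x → x ∈ u → 1 ≤ x

countAtMost-zero : ∀ u → Positive u → countAtMost 0 u ≡ 0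
countAtMost-zero [] _ = refl
countAtMost-zero (x ∷ u) pos with x ≤? 0
... | yes x≤0 = contradiction (≤-trans (pos x (here refl)) x≤0) 1+n≰n
... | no _    = countAtMost-zero u (λ y → pos y ∘ there)

countAtMost-all : ∀ v u → (∀ x → x ∈ u → x ≤ v) → countAtMost v u ≡ length u
countAtMost-all v [] _ = refl
countAtMost-all v (x ∷ u) bd with x ≤? v
... | yes _   = cong suc (countAtMost-all v u (λ y → bd y ∘ there))
... | no x≰v = contradiction (bd x (here refl)) x≰v

countAtMost>0⇒Any : ∀ v u → 0 < countAtMost v u → Any (_≤ v) u
countAtMost>0⇒Any v (x ∷ u) c>0 with x ≤? v
... | yes x≤v = here x≤v
... | no _    = there (countAtMost>0⇒Any v u c>0)

Any⇒countAtMost>0 : ∀ v u → Any (_≤ v) u → 0 < countAtMost v u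
Any⇒countAtMost>0 v (x ∷ u) any with x ≤? v
... | yes _   = s≤s z≤n
... | no x≰v = Any⇒countAtMost>0 v u (tail x≰v any)

sumBelow : (ℕ → ℕ) → ℕ → ℕ
sumBelow h zero    = 0
sumBelow h (suc v) = sumBelow h v + h v

sumBelow-cong : ∀ {h g} → (∀ k → h k ≡ g k) → ∀ v → sumBelow h v ≡ sumBelow g v
sumBelow-cong h≗g zero    = refl
sumBelow-cong h≗g (suc v) = cong₂ _+_ (sumBelow-cong h≗g v) (h≗g v)

sumBelow-suc : ∀ h v → sumBelow h (suc v) ≡ h 0 + sumBelow (h ∘ suc) v
sumBelow-suc h zero    = +-comm 0 (h 0)
sumBelow-suc h (suc v) = begin
  sumBelow h (suc v) + h (suc v)           ≡⟨ cong (_+ h (suc v)) (sumBelow-suc h v) ⟩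
  h 0 + sumBelow (h ∘ suc) v + h (suc v)   ≡⟨ +-assoc (h 0) _ _ ⟩
  h 0 + (sumBelow (h ∘ suc) v + h (suc v)) ∎
  where open ≡-Reasoning

sumBelow-zero : ∀ {h} → (∀ k → h k ≡ 0) → ∀ v → sumBelow h v ≡ 0
sumBelow-zero h≗0 zero    = refl
sumBelow-zero h≗0 (suc v) = cong₂ _+_ (sumBelow-zero h≗0 v) (h≗0 v)

module _ {h : ℕ → ℕ} {c : ℕ} (supported : ∀ k → k ≢ c → h k ≡ 0) where

  sumBelow-before-support : ∀ v → v ≤ c → sumBelow h v ≡ 0
  sumBelow-before-support zero    _     = refl
  sumBelow-before-support (suc v) 1+v≤c =
    cong₂ _+_ (sumBelow-before-support v (<⇒≤ 1+v≤c)) (supported v (<⇒≢ 1+v≤c))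

  sumBelow-past-support : ∀ v → c < v → sumBelow h v ≡ h c
  sumBelow-past-support (suc v) c<1+v with v ≟ c
  ... | yes refl = cong (_+ h v) (sumBelow-before-support v ≤-refl)
  ... | no v≢c   = trans (cong₂ _+_ (sumBelow-past-support v (≤∧≢⇒< (≤-pred c<1+v) (v≢c ∘ sym))) (supported v v≢c))
                         (+-identityʳ _)

+-sumBelow-suc : ∀ y h v → y + sumBelow h (suc v) ≡ (y + h 0) + sumBelow (h ∘ suc) v
+-sumBelow-suc y h v = trans (cong (y +_) (sumBelow-suc h v)) (sym (+-assoc y _ _))

countAtMost≡sumBelow-occ : ∀ u → Positive u → ∀ v → countAtMost v u ≡ sumBelow (λ k → occ (suc k) u) v
countAtMost≡sumBelow-occ u pos zero    = countAtMost-zero u pos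
countAtMost≡sumBelow-occ u pos (suc v) =
  trans (countAtMost-suc v u) (cong (_+ occ (suc v) u) (countAtMost≡sumBelow-occ u pos v))

occ-rrw : ∀ c Y → occ c (rrw Y) ≡ sumBelow (λ k → occ c (row Y k)) (length Y)
occ-rrw c [] = refl
occ-rrw c (ρ ∷ Y) = begin
  occ c (reverse ρ ++ rrw Y)                              ≡⟨ occ-++ c (reverse ρ) (rrw Y) ⟩
  occ c (reverse ρ) + occ c (rrw Y)                       ≡⟨ cong₂ _+_ (occ-reverse c ρ) (occ-rrw c Y) ⟩
  occ c ρ + sumBelow (λ k → occ c (row Y k)) (length Y)   ≡⟨ sumBelow-suc (λ k → occ c (row (ρ ∷ Y) k)) (length Y) ⟨
  sumBelow (λ k → occ c (row (ρ ∷ Y) k)) (length (ρ ∷ Y)) ∎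
  where open ≡-Reasoning

lookupD-beyond : ∀ {A : Set} (d : A) xs i → length xs ≤ i → lookupD d xs i ≡ d
lookupD-beyond d []       i       _             = refl
lookupD-beyond d (x ∷ xs) (suc i) (s≤s len≤i) = lookupD-beyond d xs i len≤i

part-beyond : ∀ α i → length α ≤ i → part α i ≡ 0
part-beyond = lookupD-beyond 0

part-∈ : ∀ ρ j → j < length ρ → part ρ j ∈ ρ
part-∈ (x ∷ ρ) zero    _           = here refl
part-∈ (x ∷ ρ) (suc j) (s≤s j<len) = there (part-∈ ρ j j<len)

∈-row⇒∈-rrw : ∀ Y i {x} → x ∈ row Y i → x ∈ rrw Y
∈-row⇒∈-rrw (ρ ∷ Y) zero    x∈ = ∈-++⁺ˡ (reverse⁺ x∈)
∈-row⇒∈-rrw (ρ ∷ Y) (suc i) x∈ = ∈-++⁺ʳ (reverse ρ) (∈-row⇒∈-rrw Y i x∈)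

lookupD-map-applyUpTo : ∀ {A : Set} (d : A) (g : ℕ → A) f B k → k < B →
                        lookupD d (map g (applyUpTo f B)) k ≡ g (f k)
lookupD-map-applyUpTo d g f (suc B) zero    _         = refl
lookupD-map-applyUpTo d g f (suc B) (suc k) (s≤s k<B) = lookupD-map-applyUpTo d g (f ∘ suc) B k k<B

lookupD-map-applyUpTo-beyond : ∀ {A : Set} (d : A) (g : ℕ → A) f B k → B ≤ k →
                               lookupD d (map g (applyUpTo f B)) k ≡ d
lookupD-map-applyUpTo-beyond d g f B k B≤k = lookupD-beyond d (map g (applyUpTo f B)) k
  (subst (_≤ k) (sym (trans (length-map g (applyUpTo f B)) (length-applyUpTo f B))) B≤k)

Sorted : List ℕ → Set
Sorted = AllPairs _≤_

sorted-head≤ : ∀ {x xs y} → Sorted (x ∷ xs) → y ∈ x ∷ xs → x ≤ y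
sorted-head≤ _        (here refl) = ≤-refl
sorted-head≤ (x≤ ∷ _) (there y∈)  = All.lookup x≤ y∈

indexwise⇒sorted : ∀ ρ → (∀ j → suc j < length ρ → part ρ j ≤ part ρ (suc j)) → Sorted ρ
indexwise⇒sorted []           _    = []
indexwise⇒sorted (x ∷ [])     _    = [] ∷ []
indexwise⇒sorted (x ∷ y ∷ ys) step with indexwise⇒sorted (y ∷ ys) (λ j → step (suc j) ∘ s≤s)
... | y≤ ∷ sorted = (x≤y ∷ All.map (≤-trans x≤y) y≤) ∷ y≤ ∷ sorted
  where x≤y = step 0 (s≤s (s≤s z≤n))

sorted⇒indexwise : ∀ ρ → Sorted ρ → ∀ j → suc j < length ρ → part ρ j ≤ part ρ (suc j)
sorted⇒indexwise (x ∷ y ∷ ys) ((x≤y ∷ _) ∷ _) zero    _           = x≤y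
sorted⇒indexwise (x ∷ xs)     (_ ∷ sorted)    (suc j) (s≤s 1+j<) = sorted⇒indexwise xs sorted j 1+j<

sorted-replicate : ∀ m x → Sorted (replicate m x)
sorted-replicate zero    x = []
sorted-replicate (suc m) x = All.replicate⁺ m ≤-refl ∷ sorted-replicate m x

sorted-countAtMost⁺ : ∀ {ρ} → Sorted ρ → ∀ j v → j < length ρ → part ρ j ≤ v → j < countAtMost v ρ
sorted-countAtMost⁺ {x ∷ xs} (x≤ ∷ sorted) j v j<len ρj≤v with x ≤? v
sorted-countAtMost⁺ {x ∷ xs} (x≤ ∷ sorted) zero    v _           _    | yes _ = s≤s z≤n
sorted-countAtMost⁺ {x ∷ xs} (x≤ ∷ sorted) (suc j) v (s≤s j<len) ρj≤v | yes _ =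
  s≤s (sorted-countAtMost⁺ sorted j v j<len ρj≤v)
sorted-countAtMost⁺ {x ∷ xs} (x≤ ∷ sorted) zero    v _           x≤v  | no x≰v = contradiction x≤v x≰v
sorted-countAtMost⁺ {x ∷ xs} (x≤ ∷ sorted) (suc j) v (s≤s j<len) ρj≤v | no x≰v =
  contradiction (≤-trans (All.lookup x≤ (part-∈ xs j j<len)) ρj≤v) x≰v

sorted-countAtMost⁻ : ∀ {ρ} → Sorted ρ → ∀ j v → j < countAtMost v ρ → part ρ j ≤ v
sorted-countAtMost⁻ {x ∷ xs} (x≤ ∷ sorted) j v j<c with x ≤? v
sorted-countAtMost⁻ {x ∷ xs} (x≤ ∷ sorted) zero    v _         | yes x≤v = x≤v
sorted-countAtMost⁻ {x ∷ xs} (x≤ ∷ sorted) (suc j) v (s≤s j<c) | yes _   = sorted-countAtMost⁻ sorted j v j<c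
sorted-countAtMost⁻ {x ∷ xs} (x≤ ∷ sorted) j       v j<c       | no x≰v =
  let y , y∈ , y≤v = find (countAtMost>0⇒Any v xs (≤-trans (s≤s z≤n) j<c))
  in  contradiction (≤-trans (All.lookup x≤ y∈) y≤v) x≰v

occ-sorted-injective : ∀ {a b} → Sorted a → Sorted b → (∀ x → occ x a ≡ occ x b) → a ≡ b
occ-sorted-injective {[]}    {[]}    _ _ _ = refl
occ-sorted-injective {[]}    {y ∷ b} _ _ a≗b = contradiction (sym (a≗b y)) (>⇒≢ (∈⇒occ>0 (y ∷ b) (here refl)))
occ-sorted-injective {x ∷ a} {[]}    _ _ a≗b = contradiction (a≗b x) (>⇒≢ (∈⇒occ>0 (x ∷ a) (here refl)))
occ-sorted-injective {x ∷ a} {y ∷ b} sa@(_ ∷ sa′) sb@(_ ∷ sb′) a≗b =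
  cong₂ _∷_ x≡y (occ-sorted-injective sa′ sb′ tails≗)
  where
  ∈-other : ∀ z u w → occ z u ≡ occ z w → z ∈ u → z ∈ w
  ∈-other z u w eq z∈u = occ>0⇒∈ w (subst (0 <_) eq (∈⇒occ>0 u z∈u))
  x≡y : x ≡ y
  x≡y = ≤-antisym (sorted-head≤ sa (∈-other y (y ∷ b) (x ∷ a) (sym (a≗b y)) (here refl)))
                  (sorted-head≤ sb (∈-other x (x ∷ a) (y ∷ b) (a≗b x) (here refl)))
  tails≗ : ∀ z → occ z a ≡ occ z b
  tails≗ z = +-cancelˡ-≡ (occ z (x ∷ [])) (occ z a) (occ z b) (begin
    occ z (x ∷ []) + occ z a ≡⟨ occ-++ z (x ∷ []) a ⟨
    occ z (x ∷ a)            ≡⟨ a≗b z ⟩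
    occ z (y ∷ b)            ≡⟨ occ-++ z (y ∷ []) b ⟩
    occ z (y ∷ []) + occ z b ≡⟨ cong (λ t → occ z (t ∷ []) + occ z b) x≡y ⟨
    occ z (x ∷ []) + occ z b ∎)
    where open ≡-Reasoning

-- Companion rows and transposition

rowsWith : ℕ → ℕ → List (List ℕ) → List ℕ
rowsWith k s []      = []
rowsWith k s (ρ ∷ X) = replicate (occ k ρ) (suc s) ++ rowsWith k (suc s) X

rowsWith-lower : ∀ k s X {y} → y ∈ rowsWith k s X → suc s ≤ y
rowsWith-lower k s (ρ ∷ X) y∈ with ∈-++⁻ (replicate (occ k ρ) (suc s)) y∈
... | inj₁ y∈rep  = ≤-reflexive (sym (∈-replicate⇒≡ (occ k ρ) y∈rep))
... | inj₂ y∈rest = <⇒≤ (rowsWith-lower k (suc s) X y∈rest)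

rowsWith-upper : ∀ k s X {y} → y ∈ rowsWith k s X → y ≤ s + length X
rowsWith-upper k s (ρ ∷ X) {y} y∈ with ∈-++⁻ (replicate (occ k ρ) (suc s)) y∈
... | inj₁ y∈rep  = ≤-trans (≤-reflexive (∈-replicate⇒≡ (occ k ρ) y∈rep))
                            (subst (suc s ≤_) (sym (+-suc s (length X))) (s≤s (m≤m+n s (length X))))
... | inj₂ y∈rest = subst (y ≤_) (sym (+-suc s (length X))) (rowsWith-upper k (suc s) X y∈rest)

rowsWith-sorted : ∀ k s X → Sorted (rowsWith k s X)
rowsWith-sorted k s []      = []
rowsWith-sorted k s (ρ ∷ X) =
  AllPairs.++⁺ (sorted-replicate (occ k ρ) (suc s)) (rowsWith-sorted k (suc s) X)
    (All.replicate⁺ (occ k ρ) (All.tabulate (<⇒≤ ∘ rowsWith-lower k (suc s) X)))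

occ-rowsWith : ∀ k s X i → occ (suc (s + i)) (rowsWith k s X) ≡ occ k (row X i)
occ-rowsWith k s []      i = refl
occ-rowsWith k s (ρ ∷ X) zero rewrite +-identityʳ s = begin
  occ (suc s) (replicate (occ k ρ) (suc s) ++ rowsWith k (suc s) X)
    ≡⟨ occ-++ (suc s) (replicate (occ k ρ) (suc s)) _ ⟩
  occ (suc s) (replicate (occ k ρ) (suc s)) + occ (suc s) (rowsWith k (suc s) X)
    ≡⟨ cong₂ _+_ (occ-replicate-≡ (suc s) (occ k ρ)) (∉⇒occ≡0 _ (1+n≰n ∘ rowsWith-lower k (suc s) X)) ⟩
  occ k ρ + 0
    ≡⟨ +-identityʳ _ ⟩
  occ k ρ ∎
  where open ≡-Reasoning
occ-rowsWith k s (ρ ∷ X) (suc i) rewrite +-suc s i = begin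
  occ (suc (suc s + i)) (replicate (occ k ρ) (suc s) ++ rowsWith k (suc s) X)
    ≡⟨ occ-++ (suc (suc s + i)) (replicate (occ k ρ) (suc s)) _ ⟩
  occ (suc (suc s + i)) (replicate (occ k ρ) (suc s)) + occ (suc (suc s + i)) (rowsWith k (suc s) X)
    ≡⟨ cong₂ _+_ (occ-replicate-≢ (occ k ρ) (<⇒≢ (s≤s (s≤s (m≤m+n s i))))) (occ-rowsWith k (suc s) X i) ⟩
  occ k (row X i) ∎
  where open ≡-Reasoning

companionRow≡rowsWith : ∀ X k → companionRow X k ≡ rowsWith k 0 X
companionRow≡rowsWith X k = go X (λ x → x) 0 (λ _ → refl)
  where
  go : ∀ X f s → (∀ x → f x ≡ s + x) →
       concat (zipWith (λ r ρ → replicate (occ k ρ) (suc r)) (applyUpTo f (length X)) X) ≡ rowsWith k s X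
  go []      f s f≗ = refl
  go (ρ ∷ X) f s f≗ = cong₂ _++_ (cong (λ t → replicate (occ k ρ) (suc t)) (trans (f≗ 0) (+-identityʳ s)))
                                 (go X (f ∘ suc) (suc s) (λ x → trans (f≗ (suc x)) (+-suc s x)))

AllPositive : List (List ℕ) → Set
AllPositive X = ∀ i → Positive (row X i)

AllSorted : List (List ℕ) → Set
AllSorted X = ∀ i → Sorted (row X i)

Bounded : List (List ℕ) → ℕ → Set
Bounded X B = ∀ i x → x ∈ row X i → x ≤ B

Transposed : List (List ℕ) → List (List ℕ) → Set
Transposed X Y = ∀ i k → occ (suc k) (row X i) ≡ occ (suc i) (row Y k)

transposed-sym : ∀ X Y → Transposed X Y → Transposed Y X
transposed-sym X Y t i k = sym (t k i)

companion-length : ∀ α X → length (companion α X) ≡ length α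
companion-length α X = trans (length-map _ (upTo (length α))) (length-applyUpTo (λ x → x) (length α))

row-companion : ∀ α X k → k < length α → row (companion α X) k ≡ rowsWith (suc k) 0 X
row-companion α X k k< = trans (lookupD-map-applyUpTo [] (λ k → companionRow X (suc k)) (λ x → x) (length α) k k<)
                               (companionRow≡rowsWith X (suc k))

row-companion-beyond : ∀ α X k → length α ≤ k → row (companion α X) k ≡ []
row-companion-beyond α X k = lookupD-map-applyUpTo-beyond [] (λ k → companionRow X (suc k)) (λ x → x) (length α) k

∈-row-companion : ∀ α X k {x} → x ∈ row (companion α X) k → x ∈ rowsWith (suc k) 0 X
∈-row-companion α X k x∈ with k <? length α
... | yes k< = subst (_ ∈_) (row-companion α X k k<) x∈
... | no k≮ with subst (_ ∈_) (row-companion-beyond α X k (≮⇒≥ k≮)) x∈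
...   | ()

companion-positive : ∀ α X → AllPositive (companion α X)
companion-positive α X k x = ≤-trans (s≤s z≤n) ∘ rowsWith-lower (suc k) 0 X ∘ ∈-row-companion α X k

companion-bounded : ∀ α X → Bounded (companion α X) (length X)
companion-bounded α X k x = rowsWith-upper (suc k) 0 X ∘ ∈-row-companion α X k

companion-sorted : ∀ α X → AllSorted (companion α X)
companion-sorted α X k with k <? length α
... | yes k< = subst Sorted (sym (row-companion α X k k<)) (rowsWith-sorted (suc k) 0 X)
... | no k≮ = subst Sorted (sym (row-companion-beyond α X k (≮⇒≥ k≮))) []

companion-transposed : ∀ α X → Bounded X (length α) → Transposed X (companion α X)
companion-transposed α X bounded i k with k <? length α
... | yes k< = sym (trans (cong (occ (suc i)) (row-companion α X k k<)) (occ-rowsWith (suc k) 0 X i))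
... | no k≮ = trans (∉⇒occ≡0 (row X i) (λ k+1∈ → k≮ (bounded i (suc k) k+1∈)))
                     (cong (occ (suc i)) (sym (row-companion-beyond α X k (≮⇒≥ k≮))))

length-row≡occ-rrw : ∀ X Y → Transposed X Y → AllPositive X → Bounded X (length Y) →
                     ∀ i → length (row X i) ≡ occ (suc i) (rrw Y)
length-row≡occ-rrw X Y t pos bounded i = begin
  length (row X i)                                  ≡⟨ countAtMost-all (length Y) (row X i) (bounded i) ⟨
  countAtMost (length Y) (row X i)                  ≡⟨ countAtMost≡sumBelow-occ (row X i) (pos i) (length Y) ⟩
  sumBelow (λ k → occ (suc k) (row X i)) (length Y) ≡⟨ sumBelow-cong (t i) (length Y) ⟩
  sumBelow (λ k → occ (suc i) (row Y k)) (length Y) ≡⟨ occ-rrw (suc i) Y ⟨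
  occ (suc i) (rrw Y)                               ∎
  where open ≡-Reasoning

content⇒bounded : ∀ X B → AllPositive X → (∀ k → B ≤ k → occ (suc k) (rrw X) ≡ 0) → Bounded X B
content⇒bounded X B pos absent i x x∈ with pos i x x∈
... | s≤s {n = x′} _ with x′ <? B
...   | yes x′<B = x′<B
...   | no x′≮B = contradiction (absent x′ (≮⇒≥ x′≮B)) (>⇒≢ (∈⇒occ>0 (rrw X) (∈-row⇒∈-rrw X i x∈)))

-- Ballot conditions

Ballot : ℕ → ℕ → ℕ → List ℕ → Set
Ballot a x y w = ∀ m → y + occ (suc (suc a)) (take m w) ≤ x + occ (suc a) (take m w)

-- Row v may contribute all its a+2's but only the a+1's of the rows above it.
BallotByRows : ℕ → ℕ → ℕ → List (List ℕ) → Set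
BallotByRows a x y Y =
  ∀ v → y + sumBelow (λ k → occ (suc (suc a)) (row Y k)) (suc v) ≤ x + sumBelow (λ k → occ (suc a) (row Y k)) v

module _ {a : ℕ} where

  private
    c₁ c₂ : ℕ
    c₁ = suc a
    c₂ = suc (suc a)

    +-occ-++ : ∀ c x u v → x + occ c (u ++ v) ≡ (x + occ c u) + occ c v
    +-occ-++ c x u v = trans (cong (x +_) (occ-++ c u v)) (sym (+-assoc x _ _))

    +-occ-∷ : ∀ c x z u → x + occ c (z ∷ u) ≡ (x + occ c (z ∷ [])) + occ c u
    +-occ-∷ c x z = +-occ-++ c x (z ∷ [])

  ballot-cong : ∀ {x x′ y y′ w} → x ≡ x′ → y ≡ y′ → Ballot a x y w → Ballot a x′ y′ w
  ballot-cong refl refl b = b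

  ballot-initial : ∀ {x y w} → Ballot a x y w → y ≤ x
  ballot-initial {x} {y} b = subst₂ _≤_ (+-identityʳ y) (+-identityʳ x) (b 0)

  ballot-[] : ∀ {x y} → y ≤ x → Ballot a x y []
  ballot-[] y≤x zero    = +-monoˡ-≤ 0 y≤x
  ballot-[] y≤x (suc m) = +-monoˡ-≤ 0 y≤x

  ballot-∷⁻ : ∀ {x y z w} → Ballot a x y (z ∷ w) →
              Ballot a (x + occ c₁ (z ∷ [])) (y + occ c₂ (z ∷ [])) w
  ballot-∷⁻ {x} {y} {z} {w} b m =
    subst₂ _≤_ (+-occ-∷ c₂ y z (take m w)) (+-occ-∷ c₁ x z (take m w)) (b (suc m))

  ballot-∷⁺ : ∀ {x y z w} → y ≤ x → Ballot a (x + occ c₁ (z ∷ [])) (y + occ c₂ (z ∷ [])) w →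
              Ballot a x y (z ∷ w)
  ballot-∷⁺ y≤x b zero = +-monoˡ-≤ 0 y≤x
  ballot-∷⁺ {x} {y} {z} {w} y≤x b (suc m) =
    subst₂ _≤_ (sym (+-occ-∷ c₂ y z (take m w))) (sym (+-occ-∷ c₁ x z (take m w))) (b m)

  ballot-++⁻ : ∀ u {x y w} → Ballot a x y (u ++ w) →
               Ballot a x y u × Ballot a (x + occ c₁ u) (y + occ c₂ u) w
  ballot-++⁻ [] {x} {y} b = ballot-[] (ballot-initial b) , ballot-cong (sym (+-identityʳ x)) (sym (+-identityʳ y)) b
  ballot-++⁻ (z ∷ u) {x} {y} b with ballot-++⁻ u (ballot-∷⁻ b)
  ... | bu , bw = ballot-∷⁺ (ballot-initial b) bu
                , ballot-cong (sym (+-occ-∷ c₁ x z u)) (sym (+-occ-∷ c₂ y z u)) bw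

  ballot-++⁺ : ∀ u {x y w} → Ballot a x y u → Ballot a (x + occ c₁ u) (y + occ c₂ u) w → Ballot a x y (u ++ w)
  ballot-++⁺ [] {x} {y} _ bw = ballot-cong (+-identityʳ x) (+-identityʳ y) bw
  ballot-++⁺ (z ∷ u) {x} {y} bu bw = ballot-∷⁺ (ballot-initial bu) (ballot-++⁺ u (ballot-∷⁻ bu)
    (ballot-cong (+-occ-∷ c₁ x z u) (+-occ-∷ c₂ y z u) bw))

  ballot-whole : ∀ {x y w} → Ballot a x y w → y + occ c₂ w ≤ x + occ c₁ w
  ballot-whole {x} {y} {w} b = subst (λ u → y + occ c₂ u ≤ x + occ c₁ u) (take-all (length w) w ≤-refl) (b (length w))

  ballot-∷ʳ⁺ : ∀ u z {x y} → Ballot a x y u → y + occ c₂ (u ++ z ∷ []) ≤ x + occ c₁ (u ++ z ∷ []) →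
               Ballot a x y (u ++ z ∷ [])
  ballot-∷ʳ⁺ u z {x} {y} bu whole = ballot-++⁺ u bu (ballot-∷⁺ (ballot-whole bu)
    (ballot-[] (subst₂ _≤_ (+-occ-++ c₂ y u (z ∷ [])) (+-occ-++ c₁ x u (z ∷ [])) whole)))

  ballot-reverse⁺ : ∀ {x y} ρ → y + occ c₂ ρ ≤ x → Ballot a x y (reverse ρ)
  ballot-reverse⁺ [] y≤x = ballot-[] (subst (_≤ _) (+-identityʳ _) y≤x)
  ballot-reverse⁺ {x} {y} (z ∷ ρ) bound = subst (Ballot a x y) (sym (unfold-reverse z ρ))
    (ballot-∷ʳ⁺ (reverse ρ) z (ballot-reverse⁺ ρ (≤-trans (+-monoʳ-≤ y (occ≤occ-∷ c₂ z ρ)) bound))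
      (subst (λ u → y + occ c₂ u ≤ x + occ c₁ u) (unfold-reverse z ρ)
        (≤-trans (subst (λ t → y + t ≤ x) (sym (occ-reverse c₂ (z ∷ ρ))) bound) (m≤m+n x _))))

  -- In a sorted row read backwards every c₂ precedes every c₁, so the whole row of c₂'s is the worst prefix.
  ballot-reverse-sorted⁻ : ∀ {x y ρ} → Sorted ρ → Ballot a x y (reverse ρ) → y + occ c₂ ρ ≤ x
  ballot-reverse-sorted⁻ {x} {y} {[]} _ b = subst (_≤ x) (sym (+-identityʳ y)) (ballot-initial b)
  ballot-reverse-sorted⁻ {x} {y} {z ∷ ρ} sorted@(_ ∷ sortedρ) b = by-cases (z ≟ c₂)
    where
    by-cases : Dec (z ≡ c₂) → y + occ c₂ (z ∷ ρ) ≤ x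
    by-cases (no z≢c₂) = subst (λ t → y + t ≤ x) (sym (occ-∷-≢ ρ z≢c₂))
      (ballot-reverse-sorted⁻ sortedρ (proj₁ (ballot-++⁻ (reverse ρ) (subst (Ballot a x y) (unfold-reverse z ρ) b))))
    by-cases (yes z≡c₂) = subst₂ _≤_ (cong (y +_) (occ-reverse c₂ (z ∷ ρ)))
                                     (trans (cong (x +_) (trans (occ-reverse c₁ (z ∷ ρ)) no-c₁)) (+-identityʳ x))
                                     (ballot-whole b)
      where no-c₁ : occ c₁ (z ∷ ρ) ≡ 0
            no-c₁ = ∉⇒occ≡0 (z ∷ ρ) (1+n≰n ∘ subst (_≤ c₁) z≡c₂ ∘ sorted-head≤ sorted)

  ballot⇒ballotByRows : ∀ {x y} Y → AllSorted Y → Ballot a x y (rrw Y) → BallotByRows a x y Y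
  ballot⇒ballotByRows {x} {y} [] _ b v =
    subst₂ _≤_ (cong (y +_) (sym (sumBelow-zero (λ _ → refl) (suc v))))
               (cong (x +_) (sym (sumBelow-zero (λ _ → refl) v)))
               (+-monoˡ-≤ 0 (ballot-initial b))
  ballot⇒ballotByRows {x} {y} (ρ ∷ Y) sorted b = by-rows
    where
    rest = ballot-++⁻ (reverse ρ) b
    first : y + occ c₂ ρ ≤ x
    first = ballot-reverse-sorted⁻ (sorted 0) (proj₁ rest)
    later : BallotByRows a (x + occ c₁ ρ) (y + occ c₂ ρ) Y
    later = ballot⇒ballotByRows Y (sorted ∘ suc)
      (ballot-cong (cong (x +_) (occ-reverse c₁ ρ)) (cong (y +_) (occ-reverse c₂ ρ)) (proj₂ rest))
    by-rows : BallotByRows a x y (ρ ∷ Y)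
    by-rows zero    = subst (_ ≤_) (sym (+-identityʳ x)) first
    by-rows (suc v) = subst₂ _≤_ (sym (+-sumBelow-suc y _ (suc v))) (sym (+-sumBelow-suc x _ v)) (later v)

  ballotByRows⇒ballot : ∀ {x y} Y → BallotByRows a x y Y → Ballot a x y (rrw Y)
  ballotByRows⇒ballot {x} {y} [] byRows =
    ballot-[] (subst₂ _≤_ (+-identityʳ y) (+-identityʳ x) (byRows 0))
  ballotByRows⇒ballot {x} {y} (ρ ∷ Y) byRows =
    ballot-++⁺ (reverse ρ) (ballot-reverse⁺ ρ (subst (_ ≤_) (+-identityʳ x) (byRows 0)))
      (ballot-cong (cong (x +_) (sym (occ-reverse c₁ ρ))) (cong (y +_) (sym (occ-reverse c₂ ρ)))
        (ballotByRows⇒ballot Y (λ v →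
          subst₂ _≤_ (+-sumBelow-suc y _ (suc v)) (+-sumBelow-suc x _ v) (byRows (suc v)))))

YamanouchiFrom : List ℕ → List ℕ → Set
YamanouchiFrom μ w = ∀ a → Ballot a (part μ a) (part μ (suc a)) w

part-antitone : ∀ α → IsPartition α → ∀ i → part α (suc i) ≤ part α i
part-antitone α (decreasing , _) i with suc i <? length α
... | yes 1+i< = decreasing i 1+i<
... | no 1+i≮ = subst (_≤ part α i) (sym (part-beyond α (suc i) (≮⇒≥ 1+i≮))) z≤n

row-Tμ : ∀ μ k → row (Tμ μ) k ≡ replicate (part μ k) (suc k)
row-Tμ μ = go (λ x → x) μ
  where
  go : ∀ f μ k → lookupD [] (zipWith (λ i m → replicate m (suc i)) (applyUpTo f (length μ)) μ) k
                 ≡ replicate (part μ k) (suc (f k))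
  go f []      k       = refl
  go f (m ∷ μ) zero    = refl
  go f (m ∷ μ) (suc k) = go (f ∘ suc) μ k

length-Tμ : ∀ μ → length (Tμ μ) ≡ length μ
length-Tμ = go (λ x → x)
  where
  go : ∀ f μ → length (zipWith (λ i m → replicate m (suc i)) (applyUpTo f (length μ)) μ) ≡ length μ
  go f []      = refl
  go f (m ∷ μ) = cong suc (go (f ∘ suc) μ)

module _ (μ : List ℕ) where

  private
    occ-row-Tμ-≢ : ∀ c k → k ≢ c → occ (suc c) (row (Tμ μ) k) ≡ 0
    occ-row-Tμ-≢ c k k≢c = trans (cong (occ (suc c)) (row-Tμ μ k)) (occ-replicate-≢ (part μ k) (k≢c ∘ suc-injective))

    occ-row-Tμ-≡ : ∀ c → occ (suc c) (row (Tμ μ) c) ≡ part μ c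
    occ-row-Tμ-≡ c = trans (cong (occ (suc c)) (row-Tμ μ c)) (occ-replicate-≡ (suc c) (part μ c))

  occ-rrw-Tμ : ∀ a → occ (suc a) (rrw (Tμ μ)) ≡ part μ a
  occ-rrw-Tμ a with a <? length μ
  ... | yes a< = begin
    occ (suc a) (rrw (Tμ μ))                                        ≡⟨ occ-rrw (suc a) (Tμ μ) ⟩
    sumBelow (λ k → occ (suc a) (row (Tμ μ) k)) (length (Tμ μ))     ≡⟨ sumBelow-past-support (occ-row-Tμ-≢ a) _
                                                                          (subst (a <_) (sym (length-Tμ μ)) a<) ⟩
    occ (suc a) (row (Tμ μ) a)                                       ≡⟨ occ-row-Tμ-≡ a ⟩
    part μ a                                                         ∎
    where open ≡-Reasoning
  ... | no a≮ = begin
    occ (suc a) (rrw (Tμ μ))                                        ≡⟨ occ-rrw (suc a) (Tμ μ) ⟩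
    sumBelow (λ k → occ (suc a) (row (Tμ μ) k)) (length (Tμ μ))     ≡⟨ sumBelow-before-support (occ-row-Tμ-≢ a) _
                                                                          (subst (_≤ a) (sym (length-Tμ μ)) (≮⇒≥ a≮)) ⟩
    0                                                                ≡⟨ part-beyond μ a (≮⇒≥ a≮) ⟨
    part μ a                                                         ∎
    where open ≡-Reasoning

  ballot-Tμ : IsPartition μ → ∀ a → Ballot a 0 0 (rrw (Tμ μ))
  ballot-Tμ pμ a = ballotByRows⇒ballot (Tμ μ) by-rows
    where
    by-rows : BallotByRows a 0 0 (Tμ μ)
    by-rows v with a <? v
    ... | yes a<v = subst₂ _≤_
      (sym (trans (sumBelow-past-support (occ-row-Tμ-≢ (suc a)) (suc v) (s≤s a<v)) (occ-row-Tμ-≡ (suc a))))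
      (sym (trans (sumBelow-past-support (occ-row-Tμ-≢ a) v a<v) (occ-row-Tμ-≡ a)))
      (part-antitone μ pμ a)
    ... | no a≮v =
      ≤-trans (≤-reflexive (sumBelow-before-support (occ-row-Tμ-≢ (suc a)) (suc v) (s≤s (≮⇒≥ a≮v)))) z≤n

  muDominant⇒yamanouchiFrom : ∀ R → MuDominant μ R → YamanouchiFrom μ (rrw R)
  muDominant⇒yamanouchiFrom R dominant a = ballot-cong (occ-rrw-Tμ a) (occ-rrw-Tμ (suc a))
    (proj₂ (ballot-++⁻ (rrw (Tμ μ)) (λ m → dominant m a)))

  yamanouchiFrom⇒muDominant : IsPartition μ → ∀ R → YamanouchiFrom μ (rrw R) → MuDominant μ R
  yamanouchiFrom⇒muDominant pμ R yam m a = ballot-++⁺ (rrw (Tμ μ)) (ballot-Tμ pμ a)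
    (ballot-cong (sym (occ-rrw-Tμ a)) (sym (occ-rrw-Tμ (suc a))) (yam a)) m

-- Column strictness

module _ {ρ ρ′ : List ℕ} {m m′ : ℕ} (sρ : Sorted ρ) (sρ′ : Sorted ρ′)
         (m′≤m : m′ ≤ m) (ends : m′ + length ρ′ ≤ m + length ρ) where

  private
    above : ℕ → ℕ
    above j = m′ + j ∸ m

    m+above : ∀ {j} → m ≤ m′ + j → m + above j ≡ m′ + j
    m+above {j} m≤ = trans (+-comm m (above j)) (m∸n+n≡m m≤)

    above<⇒< : ∀ {j k} → m ≤ m′ + j → m′ + j < m + k → above j < k
    above<⇒< {j} {k} m≤ lt = +-cancelˡ-< m (above j) k (subst (_< m + k) (sym (m+above m≤)) lt)

  rowsColumnStrict⇒counting : (∀ j → j < length ρ′ → m ≤ m′ + j → part ρ (above j) < part ρ′ j) →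
                              ∀ v → m′ + countAtMost (suc v) ρ′ ≤ m + countAtMost v ρ
  rowsColumnStrict⇒counting column< v with countAtMost (suc v) ρ′ in count≡
  ... | zero = ≤-trans (≤-reflexive (+-identityʳ m′)) (≤-trans m′≤m (m≤m+n m _))
  ... | suc j with m ≤? m′ + j
  ...   | no m≰ = ≤-trans (≤-reflexive (+-suc m′ j)) (≤-trans (≰⇒> m≰) (m≤m+n m _))
  ...   | yes m≤ = begin
    m′ + suc j          ≡⟨ +-suc m′ j ⟩
    suc (m′ + j)        ≡⟨ cong suc (m+above m≤) ⟨
    suc (m + above j)   ≡⟨ +-suc m (above j) ⟨
    m + suc (above j)   ≤⟨ +-monoʳ-≤ m above<count ⟩
    m + countAtMost v ρ ∎
    where
    open ≤-Reasoning
    j<len : j < length ρ′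
    j<len = ≤-trans (≤-reflexive (sym count≡)) (countAtMost≤length (suc v) ρ′)
    above<len : above j < length ρ
    above<len = above<⇒< m≤ (<-≤-trans (+-monoʳ-< m′ j<len) ends)
    above≤v : part ρ (above j) ≤ v
    above≤v = ≤-pred (≤-trans (column< j j<len m≤)
                              (sorted-countAtMost⁻ sρ′ j (suc v) (≤-reflexive (sym count≡))))
    above<count : above j < countAtMost v ρ
    above<count = sorted-countAtMost⁺ sρ (above j) v above<len above≤v

  counting⇒rowsColumnStrict : Positive ρ′ → (∀ v → m′ + countAtMost (suc v) ρ′ ≤ m + countAtMost v ρ) →
                              ∀ j → j < length ρ′ → m ≤ m′ + j → part ρ (above j) < part ρ′ j
  counting⇒rowsColumnStrict pos′ counting j j<len m≤ with part ρ′ j in entry≡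
  ... | zero  = contradiction (subst (1 ≤_) entry≡ (pos′ _ (part-∈ ρ′ j j<len))) 1+n≰n
  ... | suc v = s≤s (sorted-countAtMost⁻ sρ (above j) v above<count)
    where
    j<count : j < countAtMost (suc v) ρ′
    j<count = sorted-countAtMost⁺ sρ′ j (suc v) j<len (≤-reflexive entry≡)
    above<count : above j < countAtMost v ρ
    above<count = above<⇒< m≤ (≤-trans (≤-reflexive (sym (+-suc m′ j))) (≤-trans (+-monoʳ-≤ m′ j<count) (counting v)))

ColumnStrict : List ℕ → List (List ℕ) → Set
ColumnStrict μ T = ∀ i j → j < length (row T (suc i)) → part μ i ≤ part μ (suc i) + j →
  part (row T i) (part μ (suc i) + j ∸ part μ i) < part (row T (suc i)) j

CountingColumnStrict : List ℕ → List (List ℕ) → Set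
CountingColumnStrict μ Y =
  ∀ i v → part μ (suc i) + countAtMost (suc v) (row Y (suc i)) ≤ part μ i + countAtMost v (row Y i)

module _ (ν μ : List ℕ) (X : List (List ℕ)) (pν : IsPartition ν) (pμ : IsPartition μ)
         (shape : ∀ i → length (row X i) + part μ i ≡ part ν i) (sorted : AllSorted X) where

  private
    ends : ∀ i → part μ (suc i) + length (row X (suc i)) ≤ part μ i + length (row X i)
    ends i = subst₂ _≤_ (trans (sym (shape (suc i))) (+-comm (length (row X (suc i))) _))
                        (trans (sym (shape i)) (+-comm (length (row X i)) _))
                        (part-antitone ν pν i)

  columnStrict⇒counting : ColumnStrict μ X → CountingColumnStrict μ X
  columnStrict⇒counting strict i =
    rowsColumnStrict⇒counting (sorted i) (sorted (suc i)) (part-antitone μ pμ i) (ends i) (strict i)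

  counting⇒columnStrict : AllPositive X → CountingColumnStrict μ X → ColumnStrict μ X
  counting⇒columnStrict pos counting i =
    counting⇒rowsColumnStrict (sorted i) (sorted (suc i)) (part-antitone μ pμ i) (ends i) (pos (suc i)) (counting i)

module _ (X Y : List (List ℕ)) (t : Transposed X Y) (pos : AllPositive Y) where

  private
    sumBelow-occ≡countAtMost : ∀ a v → sumBelow (λ k → occ (suc a) (row X k)) v ≡ countAtMost v (row Y a)
    sumBelow-occ≡countAtMost a v =
      trans (sumBelow-cong (λ k → t k a) v) (sym (countAtMost≡sumBelow-occ (row Y a) (pos a) v))

  yamanouchiFrom⇒countingColumnStrict : ∀ μ → AllSorted X → YamanouchiFrom μ (rrw X) → CountingColumnStrict μ Y
  yamanouchiFrom⇒countingColumnStrict μ sorted yam a v =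
    subst₂ _≤_ (cong (part μ (suc a) +_) (sumBelow-occ≡countAtMost (suc a) (suc v)))
               (cong (part μ a +_) (sumBelow-occ≡countAtMost a v))
               (ballot⇒ballotByRows X sorted (yam a) v)

  countingColumnStrict⇒yamanouchiFrom : ∀ μ → CountingColumnStrict μ Y → YamanouchiFrom μ (rrw X)
  countingColumnStrict⇒yamanouchiFrom μ counting a = ballotByRows⇒ballot X λ v →
    subst₂ _≤_ (cong (part μ (suc a) +_) (sym (sumBelow-occ≡countAtMost (suc a) (suc v))))
               (cong (part μ a +_) (sym (sumBelow-occ≡countAtMost a v)))
               (counting a v)

-- The Sundaram condition

even-or-odd : ∀ y → ∃ λ j → y ≡ j + j ⊎ y ≡ suc (j + j)
even-or-odd zero = 0 , inj₁ refl
even-or-odd (suc y) with even-or-odd y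
... | j , inj₁ y≡j+j    = j , inj₂ (cong suc y≡j+j)
... | j , inj₂ y≡1+j+j = suc j , inj₁ (trans (cong suc y≡1+j+j) (sym (cong suc (+-suc j j))))

[2+t]/2≡1+t/2 : ∀ t → suc (suc t) / 2 ≡ suc (t / 2)
[2+t]/2≡1+t/2 t = m/n≡1+[m∸n]/n {suc (suc t)} {2} (s≤s (s≤s z≤n))

[j+j]/2≡j : ∀ j → (j + j) / 2 ≡ j
[j+j]/2≡j zero    = refl
[j+j]/2≡j (suc j) =
  trans (cong (λ t → suc t / 2) (+-suc j j)) (trans ([2+t]/2≡1+t/2 (j + j)) (cong suc ([j+j]/2≡j j)))

[1+j+j]/2≡j : ∀ j → suc (j + j) / 2 ≡ j
[1+j+j]/2≡j zero    = refl
[1+j+j]/2≡j (suc j) =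
  trans (cong (λ t → suc (suc t) / 2) (+-suc j j)) (trans ([2+t]/2≡1+t/2 (suc (j + j))) (cong suc ([1+j+j]/2≡j j)))

2*i+1≡1+[i+i] : ∀ i → 2 * i + 1 ≡ suc (i + i)
2*i+1≡1+[i+i] i = trans (+-comm (2 * i) 1) (cong (λ t → suc (i + t)) (+-identityʳ i))

smaller-entry-above : ∀ {μ T} → CountingColumnStrict μ T → ∀ {q w} → part μ q ≡ 0 →
              suc w ∈ row T (suc q) → Any (_≤ w) (row T q)
smaller-entry-above {μ} {T} counting {q} {w} μq≡0 w+1∈ = countAtMost>0⇒Any w (row T q) (begin
  1                                                             ≤⟨ Any⇒countAtMost>0 (suc w) _ (lose w+1∈ ≤-refl) ⟩
  countAtMost (suc w) (row T (suc q))                           ≤⟨ m≤n+m _ (part μ (suc q)) ⟩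
  part μ (suc q) + countAtMost (suc w) (row T (suc q))          ≤⟨ counting q w ⟩
  part μ q + countAtMost w (row T q)                            ≡⟨ cong (_+ countAtMost w (row T q)) μq≡0 ⟩
  countAtMost w (row T q)                                       ∎)
  where open ≤-Reasoning

module _ {n : ℕ} {μ λ′ : List ℕ} {T : List (List ℕ)} (ℓμ≤n : length μ ≤ n) (counting : CountingColumnStrict μ T)
         (sundaram : Sundaram n λ′ T) (pos : AllPositive T) (bounded : Bounded T (length λ′)) where

  sundaram⇒row≤ : ∀ y q → y ∈ row T q → suc q ≤ n + y / 2
  sundaram⇒row≤ = <-rec _ step
    where
    step : ∀ y → (∀ {y′} → y′ < y → ∀ q → y′ ∈ row T q → suc q ≤ n + y′ / 2) →
           ∀ q → y ∈ row T q → suc q ≤ n + y / 2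
    step y ih q y∈ with even-or-odd y
    ... | zero , inj₁ refl = contradiction (pos q 0 y∈) λ ()
    ... | j , inj₂ refl = subst (λ t → suc q ≤ n + t) (sym ([1+j+j]/2≡j j))
      (sundaram j q j≤ (subst (_∈ row T q) (sym (2*i+1≡1+[i+i] j)) y∈))
      where
      j≤ : j ≤ length λ′ / 2
      j≤ = subst (_≤ length λ′ / 2) ([j+j]/2≡j j) (/-monoˡ-≤ 2 (<⇒≤ (bounded q _ y∈)))
    ... | suc j , inj₁ refl = subst (λ t → suc q ≤ n + t) (sym ([j+j]/2≡j (suc j))) (by-cases q y∈)
      where
      by-cases : ∀ q → suc j + suc j ∈ row T q → suc q ≤ n + suc j
      by-cases q y∈ with suc q ≤? n + suc j
      ... | yes q<  = q<
      by-cases zero y∈     | no q≮ = contradiction (subst (1 ≤_) (sym (+-suc n j)) (s≤s z≤n)) q≮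
      by-cases (suc q′) y∈ | no q≮ = contradiction (≤-trans q′<n+j n+j≤q′) 1+n≰n
        where
        n+j≤q′ : n + j ≤ q′
        n+j≤q′ = ≤-pred (subst (_≤ suc q′) (+-suc n j) (≤-pred (≰⇒> q≮)))
        μq′≡0 : part μ q′ ≡ 0
        μq′≡0 = part-beyond μ q′ (≤-trans ℓμ≤n (≤-trans (m≤m+n n j) n+j≤q′))
        smaller : ∃ λ y′ → y′ ∈ row T q′ × y′ ≤ j + suc j
        smaller = find (smaller-entry-above {μ} {T} counting μq′≡0 y∈)
        y′ : ℕ
        y′ = proj₁ smaller
        y′≤1+j+j : y′ ≤ suc (j + j)
        y′≤1+j+j = subst (y′ ≤_) (+-suc j j) (proj₂ (proj₂ smaller))
        q′<n+j : suc q′ ≤ n + j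
        q′<n+j = ≤-trans (ih (s≤s (subst (y′ ≤_) (sym (+-suc j j)) y′≤1+j+j)) q′ (proj₁ (proj₂ smaller)))
                         (+-monoʳ-≤ n (≤-trans (/-monoˡ-≤ 2 y′≤1+j+j) (≤-reflexive ([1+j+j]/2≡j j))))

[]-partition : IsPartition []
[]-partition = (λ _ ()) , (λ _ ())

skewSSYT-sorted : ∀ ν μ T → IsSkewSSYT ν μ T → AllSorted T
skewSSYT-sorted _ _ _ (_ , _ , indexwise , _) i = indexwise⇒sorted _ (indexwise i)

row-ext : ∀ {A B : List (List ℕ)} → length A ≡ length B → (∀ k → row A k ≡ row B k) → A ≡ B
row-ext {[]}    {[]}    _   _     = refl
row-ext {a ∷ A} {b ∷ B} len rows≡ = cong₂ _∷_ (rows≡ 0) (row-ext (suc-injective len) (rows≡ ∘ suc))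

∈-row⇒<length : ∀ Y r {x} → x ∈ row Y r → r < length Y
∈-row⇒<length (ρ ∷ Y) zero    _  = s≤s z≤n
∈-row⇒<length (ρ ∷ Y) (suc r) x∈ = s≤s (∈-row⇒<length Y r x∈)

length-row-companion : ∀ α X → Bounded X (length α) →
                       ∀ i → length (row (companion α X) i) ≡ occ (suc i) (rrw X)
length-row-companion α X bounded =
  length-row≡occ-rrw (companion α X) X (transposed-sym X (companion α X) (companion-transposed α X bounded))
                     (companion-positive α X) (companion-bounded α X)

occ-rrw-companion : ∀ α X → AllPositive X → Bounded X (length α) →
                    ∀ k → occ (suc k) (rrw (companion α X)) ≡ length (row X k)
occ-rrw-companion α X pos bounded k = sym (length-row≡occ-rrw X (companion α X) (companion-transposed α X bounded) pos
                                            (subst (Bounded X) (sym (companion-length α X)) bounded) k)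

companion-skewSSYT : ∀ ν μ X → IsPartition ν → IsPartition μ →
                     (∀ i → length (row (companion ν X) i) + part μ i ≡ part ν i) →
                     CountingColumnStrict μ (companion ν X) → IsSkewSSYT ν μ (companion ν X)
companion-skewSSYT ν μ X pν pμ shape counting =
  (companion-length ν X , shape) , companion-positive ν X , (λ i → sorted⇒indexwise _ (companion-sorted ν X i)) ,
  counting⇒columnStrict ν μ (companion ν X) pν pμ shape (companion-sorted ν X) (companion-positive ν X) counting

transposed⇒companion≡ : ∀ α X Y → Transposed X Y → AllSorted Y → AllPositive Y → length Y ≡ length α →
                        companion α X ≡ Y
transposed⇒companion≡ α X Y t sorted pos len = row-ext (trans (companion-length α X) (sym len)) rows≡
  where
  rows≡ : ∀ k → row (companion α X) k ≡ row Y k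
  rows≡ k with k <? length α
  ... | no k≮ = trans (row-companion-beyond α X k (≮⇒≥ k≮))
                      (sym (lookupD-beyond [] Y k (subst (_≤ k) (sym len) (≮⇒≥ k≮))))
  ... | yes k< = trans (row-companion α X k k<)
                       (occ-sorted-injective (rowsWith-sorted (suc k) 0 X) (sorted k) same-occ)
    where
    same-occ : ∀ x → occ x (rowsWith (suc k) 0 X) ≡ occ x (row Y k)
    same-occ zero    = trans (∉⇒occ≡0 _ (λ 0∈ → contradiction (rowsWith-lower (suc k) 0 X 0∈) λ ()))
                             (sym (∉⇒occ≡0 _ (λ 0∈ → contradiction (pos k 0 0∈) λ ())))
    same-occ (suc i) = trans (occ-rowsWith (suc k) 0 X i) (t i k)

LR-bounded : ∀ ν μ λ′ T → IsLR ν μ λ′ T → Bounded T (length λ′)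
LR-bounded _ _ λ′ T ((_ , pos , _) , content , _) =
  content⇒bounded T (length λ′) pos (λ k k≥ → trans (content k) (part-beyond λ′ k k≥))

LR⇒companion-LRdom : ∀ ν μ λ′ T → IsPartition ν → IsPartition μ → IsPartition λ′ → IsLR ν μ λ′ T →
                     IsLRdom ν μ λ′ (companion λ′ T)
LR⇒companion-LRdom ν μ λ′ T pν pμ pλ lr@(ssyt@((_ , shapeT) , posT , _ , strictT) , content , yamanouchi) =
  companion-skewSSYT λ′ [] T pλ []-partition shapeR countingR , dominant , contentR
  where
  R : List (List ℕ)
  R = companion λ′ T
  sortedT : AllSorted T
  sortedT = skewSSYT-sorted ν μ T ssyt
  bounded : Bounded T (length λ′)
  bounded = LR-bounded ν μ λ′ T lr
  t : Transposed T R
  t = companion-transposed λ′ T bounded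
  shapeR : ∀ i → length (row R i) + 0 ≡ part λ′ i
  shapeR i = trans (+-identityʳ _) (trans (length-row-companion λ′ T bounded i) (content i))
  countingR : CountingColumnStrict [] R
  countingR = yamanouchiFrom⇒countingColumnStrict T R t (companion-positive λ′ T) [] sortedT (λ a m → yamanouchi m a)
  dominant : MuDominant μ R
  dominant = yamanouchiFrom⇒muDominant μ pμ R (countingColumnStrict⇒yamanouchiFrom R T (transposed-sym T R t) posT μ
                                                (columnStrict⇒counting ν μ T pν pμ shapeT sortedT strictT))
  contentR : ∀ k → occ (suc k) (rrw R) ≡ part ν k ∸ part μ k
  contentR k = begin
    occ (suc k) (rrw R)                     ≡⟨ occ-rrw-companion λ′ T posT bounded k ⟩
    length (row T k)                        ≡⟨ m+n∸n≡m _ (part μ k) ⟨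
    length (row T k) + part μ k ∸ part μ k  ≡⟨ cong (_∸ part μ k) (shapeT k) ⟩
    part ν k ∸ part μ k                     ∎
    where open ≡-Reasoning

LRS⇒companion-SSYTφ : ∀ n ν μ λ′ T → IsPartition ν → IsPartition μ → IsPartition λ′ → length μ ≤ n →
                      IsLRS n ν μ λ′ T → IsSSYTφ n λ′ (companion λ′ T)
LRS⇒companion-SSYTφ n ν μ λ′ T pν pμ pλ ℓμ≤n (lr@(ssyt@((_ , shapeT) , posT , _ , strictT) , _) , sundaram) =
  proj₁ (LR⇒companion-LRdom ν μ λ′ T pν pμ pλ lr) , φ-bound
  where
  bounded : Bounded T (length λ′)
  bounded = LR-bounded ν μ λ′ T lr
  row≤ : ∀ y q → y ∈ row T q → suc q ≤ n + y / 2
  row≤ = sundaram⇒row≤ {n} {μ} {λ′} {T} ℓμ≤n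
           (columnStrict⇒counting ν μ T pν pμ shapeT (skewSSYT-sorted ν μ T ssyt) strictT) sundaram posT bounded
  φ-bound : ∀ r x → suc r ≤ 2 * n → x ∈ row (companion λ′ T) r → x ≤ φ n (suc r)
  φ-bound r x _ x∈ with companion-positive λ′ T r x x∈
  ... | s≤s {n = q} _ = row≤ (suc r) q (occ>0⇒∈ (row T q)
    (subst (0 <_) (sym (companion-transposed λ′ T bounded q r)) (∈⇒occ>0 _ x∈)))

LRdom-bounded : ∀ ν μ λ′ R → IsLRdom ν μ λ′ R → Bounded R (length ν)
LRdom-bounded ν μ _ R ((_ , pos , _) , _ , content) = content⇒bounded R (length ν) pos λ k k≥ →
  trans (content k) (trans (cong (_∸ part μ k) (part-beyond ν k k≥)) (0∸n≡0 (part μ k)))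

LRdom⇒companion-LR : ∀ ν μ λ′ R → IsPartition ν → IsPartition μ → IsPartition λ′ → μ ⊆ᵖ ν →
                     IsLRdom ν μ λ′ R → IsLR ν μ λ′ (companion ν R)
LRdom⇒companion-LR ν μ λ′ R pν pμ pλ μ⊆ν dom@(ssyt@((_ , shapeR) , posR , _ , strictR) , dominant , content) =
  companion-skewSSYT ν μ R pν pμ shapeT countingT , contentT , yamanouchiT
  where
  T : List (List ℕ)
  T = companion ν R
  sortedR : AllSorted R
  sortedR = skewSSYT-sorted λ′ [] R ssyt
  bounded : Bounded R (length ν)
  bounded = LRdom-bounded ν μ λ′ R dom
  t : Transposed R T
  t = companion-transposed ν R bounded
  shapeT : ∀ i → length (row T i) + part μ i ≡ part ν i
  shapeT i = trans (cong (_+ part μ i) (trans (length-row-companion ν R bounded i) (content i))) (m∸n+n≡m (μ⊆ν i))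
  countingT : CountingColumnStrict μ T
  countingT = yamanouchiFrom⇒countingColumnStrict R T t (companion-positive ν R) μ sortedR
                (muDominant⇒yamanouchiFrom μ R dominant)
  contentT : HasContent (rrw T) λ′
  contentT k = trans (occ-rrw-companion ν R posR bounded k) (trans (sym (+-identityʳ _)) (shapeR k))
  yamanouchiT : Yamanouchi (rrw T)
  yamanouchiT m a = countingColumnStrict⇒yamanouchiFrom T R (transposed-sym R T t) posR []
                      (columnStrict⇒counting λ′ [] R pλ []-partition shapeR sortedR strictR) a m

LRdom⇒companion-companion : ∀ ν μ λ′ R → IsLRdom ν μ λ′ R → companion λ′ (companion ν R) ≡ R
LRdom⇒companion-companion ν μ λ′ R dom@(ssyt@((lengthR , _) , posR , _) , _) =
  transposed⇒companion≡ λ′ (companion ν R) R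
    (transposed-sym R (companion ν R) (companion-transposed ν R (LRdom-bounded ν μ λ′ R dom)))
    (skewSSYT-sorted λ′ [] R ssyt) posR lengthR

LRdom⇒companion-sundaram : ∀ n ν μ λ′ R → length ν ≤ 2 * n ∸ 1 → IsLRdom ν μ λ′ R → IsSSYTφ n λ′ R →
                           Sundaram n λ′ (companion ν R)
LRdom⇒companion-sundaram n ν μ λ′ R ℓν≤ dom (_ , φ-bound) i r _ 2i+1∈ with suc (i + i) ≤? 2 * n
... | yes 2i+1≤2n = subst (λ t → suc r ≤ n + t) ([1+j+j]/2≡j i) (φ-bound (i + i) (suc r) 2i+1≤2n r+1∈)
  where
  r+1∈ : suc r ∈ row R (i + i)
  r+1∈ = occ>0⇒∈ (row R (i + i)) (subst (0 <_) (sym (companion-transposed ν R (LRdom-bounded ν μ λ′ R dom) (i + i) r))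
           (∈⇒occ>0 _ (subst (_∈ row (companion ν R) r) (2*i+1≡1+[i+i] i) 2i+1∈)))
... | no 2i+1≰2n = begin
  suc r                   ≤⟨ subst (suc r ≤_) (companion-length ν R) (∈-row⇒<length (companion ν R) r 2i+1∈) ⟩
  length ν                ≤⟨ ℓν≤ ⟩
  2 * n ∸ 1               ≤⟨ m∸n≤m (2 * n) 1 ⟩
  n + (n + 0)             ≤⟨ +-monoʳ-≤ n (subst (_≤ i) (sym (+-identityʳ n)) n≤i) ⟩
  n + i                   ∎
  where
  open ≤-Reasoning
  n≤i : n ≤ i
  n≤i = ≮⇒≥ λ i<n → 2i+1≰2n (subst (suc (i + i) ≤_) (cong (n +_) (sym (+-identityʳ n))) (+-mono-< i<n i<n))

proposition4p7 : (n : ℕ) → 1 ≤ n → (ν μ λ′ : List ℕ) →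
    IsPartition ν → IsPartition μ → IsPartition λ′ →
    length ν ≤ 2 * n ∸ 1 → length μ ≤ n → IsEven λ′ → λ′ ⊆ᵖ ν → μ ⊆ᵖ ν →
    (R : List (List ℕ)) →
    (Σ (List (List ℕ)) (λ T → IsLRS n ν μ λ′ T × companion λ′ T ≡ R))
      ⇔ (IsLRdom ν μ λ′ R × IsSSYTφ n λ′ R)
proposition4p7 n _ ν μ λ′ pν pμ pλ ℓν≤ ℓμ≤n _ _ μ⊆ν R = mk⇔ image⊆ ⊆image
  where
  image⊆ : Σ (List (List ℕ)) (λ T → IsLRS n ν μ λ′ T × companion λ′ T ≡ R) → IsLRdom ν μ λ′ R × IsSSYTφ n λ′ R
  image⊆ (T , lrs , refl) =
    LR⇒companion-LRdom ν μ λ′ T pν pμ pλ (proj₁ lrs) , LRS⇒companion-SSYTφ n ν μ λ′ T pν pμ pλ ℓμ≤n lrs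

  ⊆image : IsLRdom ν μ λ′ R × IsSSYTφ n λ′ R → Σ (List (List ℕ)) (λ T → IsLRS n ν μ λ′ T × companion λ′ T ≡ R)
  ⊆image (dom , φ-bounded) =
    companion ν R ,
    (LRdom⇒companion-LR ν μ λ′ R pν pμ pλ μ⊆ν dom , LRdom⇒companion-sundaram n ν μ λ′ R ℓν≤ dom φ-bounded) ,
    LRdom⇒companion-companion ν μ λ′ R dom
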